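{- For every $\pi\in S_n$, $2c(\Gamma(\pi))\leq n-1+c(\Gamma(\overline{\pi}))$.
   Context: Permutations are composed right to left; $\pi\in S_n$ is written $\langle \pi_1\ \cdots\ \pi_n\rangle$, $\pi_i=\pi(i)$, and identified with the permutation of $\{0,\ldots,n\}$ fixing $0$ when forming $\overline{\pi}=(0,1,2,\ldots,n)\circ(0,\pi_n,\pi_{n-1},\ldots,\pi_1)$, a permutation of $\{0,\ldots,n\}$. For a permutation $\sigma$ of a finite set, $c(\Gamma(\sigma))$ is the number of cycles of $\sigma$ in its disjoint cycle decomposition, fixed points included. Here $\Gamma(\pi)$ is the digraph of $\pi$ as a permutation of $\{1,\ldots,n\}$. -}

module Defs where

open import Data.Nat as ℕ using (ℕ; zero; suc)
open import Data.Fin as Fin using (Fin; zero; suc; toℕ; lower₁; inject₁; fromℕ)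
open import Data.Fin.Properties using (all?; _≤?_)
open import Data.Fin.Permutation using (Permutation′; _⟨$⟩ʳ_; _⟨$⟩ˡ_)
open import Relation.Nullary using (yes; no)
open import Data.List using (length; filter; allFin)

iter : ∀ {A : Set} → (A → A) → ℕ → A → A
iter f zero    x = x
iter f (suc k) x = f (iter f k x)

IsCycleMin : ∀ {m} → (Fin m → Fin m) → Fin m → Set
IsCycleMin {m} f i = (k : Fin m) → i Fin.≤ iter f (toℕ k) i

-- Number of cycles (fixed points included) of a permutation σ of Fin m:
-- each cycle is counted once, via its least element.
numCycles : ∀ {m} → (Fin m → Fin m) → ℕ
numCycles {m} σ = length (filter (λ i → all? {n = m} (λ k → i ≤? iter σ (toℕ k) i)) (allFin m))

-- c(Γ(π)) for π ∈ S_n, a permutation of {1,…,n} (encoded as Fin n, j ↦ j+1)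
cΓ : ∀ {n} → Permutation′ n → ℕ
cΓ π = numCycles (π ⟨$⟩ʳ_)

-- The set {0,…,n} is Fin (suc n); i ∈ {1,…,n} is suc (its Fin n code).

-- the cycle (0,1,2,…,n) : x ↦ x+1 mod (n+1)
shiftCycle : ∀ {n} → Fin (suc n) → Fin (suc n)
shiftCycle {n} x with n ℕ.≟ toℕ x
... | yes _ = zero
... | no ne = suc (lower₁ x ne)

-- the cycle (0, π_n, π_{n-1}, …, π_1):
-- 0 ↦ π_n,  π_k ↦ π_{k-1} (k ≥ 2),  π_1 ↦ 0   (identity when n = 0)
revCycle : ∀ {n} → Permutation′ n → Fin (suc n) → Fin (suc n)
revCycle {zero}  π zero    = zero
revCycle {suc n} π zero    = suc (π ⟨$⟩ʳ fromℕ n)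
revCycle {suc n} π (suc j) with π ⟨$⟩ˡ j
... | zero   = zero
... | suc k  = suc (π ⟨$⟩ʳ inject₁ k)

-- π̄ = (0,1,…,n) ∘ (0,π_n,…,π_1), composed right to left
πbar : ∀ {n} → Permutation′ n → Fin (suc n) → Fin (suc n)
πbar π x = shiftCycle (revCycle π x)

module Submission where

open import Defs
open import Data.Nat using (ℕ; _+_; _*_; _≤_)
open import Data.Fin.Permutation using (Permutation′)

-- Induct on the number of points moved by π.  If π moves a, then
-- π′ = (a π(a)) ∘ π fixes a and otherwise has the cycles of π, so
-- c(Γ(π′)) ≥ c(Γ(π)) + 1 and π′ fixes more points.  Moreover π̄′ differs from
-- π̄ by a transposition on each side, and multiplying a permutation by a
-- transposition destroys at most one cycle, so c(π̄′) ≤ c(π̄) + 2.  Hence the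
-- inequality for π′ implies it for π; for the identity both sides equal 2n + 1.

import Data.Nat as ℕ
open import Data.Nat.Base using (NonZero; zero; suc; _<_; _∸_; _%_; _/_; z≤n; s≤s)
open import Data.Nat.Properties
  using ( ≤-trans; ≤-reflexive; ≤-antisym; <-trans; <-≤-trans; ≤-<-trans; <-irrefl
        ; ≰⇒>; <⇒≱; m≤n⇒m≤1+n; n<1+n; m≤m+n; m≤n+m; m+[n∸m]≡n
        ; +-comm; +-suc; *-suc; +-cancelˡ-≤; +-monoˡ-≤; +-monoʳ-≤; *-monoʳ-≤
        ; module ≤-Reasoning )
open import Data.Nat.DivMod using (m≡m%n+[m/n]*n; m%n<n)
open import Data.Nat.Tactic.RingSolver using (solve-∀)
open import Data.Fin.Base as Fin using (Fin; zero; suc; toℕ; fromℕ; fromℕ<; inject₁)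
import Data.Fin.Properties as Finₚ
open import Data.Fin.Induction using (<-wellFounded)
open import Data.Fin.Permutation
  using ( _⟨$⟩ʳ_; _⟨$⟩ˡ_; inverseˡ; _∘ₚ_; _≈_; flip; permutation; transpose
        ; lift₀; lift₀-comp; lift₀-transpose )
open import Data.List.Base using (List; []; _∷_; length; filter; allFin)
open import Data.List.Properties using (filter-all; filter-notAll; length-tabulate)
open import Data.List.Relation.Unary.All as All using (All; []; _∷_)
open import Data.List.Relation.Unary.Any using (Any; here; there)
open import Data.List.Relation.Unary.AllPairs using (_∷_)
open import Data.List.Relation.Unary.Unique.Propositional using (Unique)
open import Data.List.Relation.Unary.Unique.Propositional.Properties using (allFin⁺)
open import Data.List.Membership.Propositional using (lose)
open import Data.List.Membership.Propositional.Properties using (∈-allFin)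
open import Data.Product.Base using (∃-syntax; _×_; _,_)
open import Data.Sum.Base using (_⊎_; inj₁; inj₂)
open import Data.Empty using (⊥; ⊥-elim)
open import Function.Base using (id; _∘_)
open import Function.Definitions using (Injective)
open import Induction.WellFounded using (Acc; acc)
open import Relation.Nullary using (¬_; yes; no; contradiction)
open import Relation.Nullary.Decidable using (decidable-stable)
open import Relation.Unary using (Pred; Decidable)
open import Relation.Binary.PropositionalEquality
  using (_≡_; _≢_; _≗_; refl; sym; trans; cong; subst; module ≡-Reasoning)

length-filter-mono : ∀ {a p q} {A : Set a} {P : Pred A p} {Q : Pred A q}
  (P? : Decidable P) (Q? : Decidable Q) {xs : List A} →
  All (λ x → P x → Q x) xs → length (filter P? xs) ≤ length (filter Q? xs)
length-filter-mono P? Q? {[]}     []          = z≤n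
length-filter-mono P? Q? {x ∷ xs} (P⇒Q ∷ hs) with P? x | Q? x
... | yes p | yes _ = s≤s (length-filter-mono P? Q? hs)
... | yes p | no ¬q = contradiction (P⇒Q p) ¬q
... | no _  | yes _ = m≤n⇒m≤1+n (length-filter-mono P? Q? hs)
... | no _  | no _  = length-filter-mono P? Q? hs

length-filter-mono-< : ∀ {a p q} {A : Set a} {P : Pred A p} {Q : Pred A q}
  (P? : Decidable P) (Q? : Decidable Q) {xs : List A} →
  All (λ x → P x → Q x) xs → Any (λ x → Q x × ¬ P x) xs →
  length (filter P? xs) < length (filter Q? xs)
length-filter-mono-< P? Q? {x ∷ xs} (_ ∷ hs) (here (q , ¬p)) with P? x | Q? x
... | yes p | _     = contradiction p ¬p
... | no _  | yes _ = s≤s (length-filter-mono P? Q? hs)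
... | no _  | no ¬q = contradiction q ¬q
length-filter-mono-< P? Q? {x ∷ xs} (P⇒Q ∷ hs) (there w) with P? x | Q? x
... | yes p | yes _ = s≤s (length-filter-mono-< P? Q? hs w)
... | yes p | no ¬q = contradiction (P⇒Q p) ¬q
... | no _  | yes _ = m≤n⇒m≤1+n (length-filter-mono-< P? Q? hs w)
... | no _  | no _  = length-filter-mono-< P? Q? hs w

length-filter-≤-suc : ∀ {a p q} {A : Set a} {P : Pred A p} {Q : Pred A q}
  (P? : Decidable P) (Q? : Decidable Q) {xs : List A} → Unique xs →
  (∀ {x y} → Q x → ¬ P x → Q y → ¬ P y → x ≡ y) →
  length (filter Q? xs) ≤ suc (length (filter P? xs))
length-filter-≤-suc P? Q? {[]} _ _ = z≤n
length-filter-≤-suc {P = P} {Q} P? Q? {x ∷ xs} (x∉xs ∷ u) atMostOne with Q? x | P? x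
... | yes _ | yes _ = s≤s (length-filter-≤-suc P? Q? u atMostOne)
... | yes q | no ¬p = s≤s (length-filter-mono Q? P? (All.map Q⇒P x∉xs))
  where
  Q⇒P : ∀ {y} → x ≢ y → Q y → P y
  Q⇒P {y} x≢y qy = decidable-stable (P? y) (λ ¬py → x≢y (atMostOne q ¬p qy ¬py))
... | no _  | yes _ = m≤n⇒m≤1+n (length-filter-≤-suc P? Q? u atMostOne)
... | no _  | no _  = length-filter-≤-suc P? Q? u atMostOne

iter-+ : ∀ {A : Set} (f : A → A) m n x → iter f (m + n) x ≡ iter f m (iter f n x)
iter-+ f zero    n x = refl
iter-+ f (suc m) n x = cong f (iter-+ f m n x)

iter-cong : ∀ {A : Set} {f g : A → A} → f ≗ g → ∀ k x → iter f k x ≡ iter g k x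
iter-cong         f≗g zero    x = refl
iter-cong {f = f} f≗g (suc k) x = trans (cong f (iter-cong f≗g k x)) (f≗g _)

iter-fixedPoint : ∀ {A : Set} (f : A → A) {x} → f x ≡ x → ∀ k → iter f k x ≡ x
iter-fixedPoint f fx≡x zero    = refl
iter-fixedPoint f fx≡x (suc k) = trans (cong f (iter-fixedPoint f fx≡x k)) fx≡x

iter-* : ∀ {A : Set} (f : A → A) {n x} → iter f n x ≡ x → ∀ q → iter f (q * n) x ≡ x
iter-* f         fⁿx≡x zero    = refl
iter-* f {n} {x} fⁿx≡x (suc q) = begin
  iter f (n + q * n) x        ≡⟨ iter-+ f n (q * n) x ⟩
  iter f n (iter f (q * n) x) ≡⟨ cong (iter f n) (iter-* f fⁿx≡x q) ⟩
  iter f n x                  ≡⟨ fⁿx≡x ⟩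
  x                           ∎
  where open ≡-Reasoning

iter-% : ∀ {A : Set} (f : A → A) {n x} .{{_ : NonZero n}} → iter f n x ≡ x →
  ∀ k → iter f k x ≡ iter f (k % n) x
iter-% f {n} {x} fⁿx≡x k = begin
  iter f k x                              ≡⟨ cong (λ j → iter f j x) (m≡m%n+[m/n]*n k n) ⟩
  iter f (k % n + (k / n) * n) x          ≡⟨ iter-+ f (k % n) _ x ⟩
  iter f (k % n) (iter f ((k / n) * n) x) ≡⟨ cong (iter f (k % n)) (iter-* f fⁿx≡x (k / n)) ⟩
  iter f (k % n) x                        ∎
  where open ≡-Reasoning

Reachable : ∀ {A : Set} → (A → A) → A → A → Set
Reachable f x y = ∃[ k ] iter f k x ≡ y

module _ {A : Set} {f : A → A} where

  reachable-refl : ∀ {x} → Reachable f x x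
  reachable-refl = 0 , refl

  reachable-step : ∀ x → Reachable f x (f x)
  reachable-step x = 1 , refl

  reachable-trans : ∀ {x y z} → Reachable f x y → Reachable f y z → Reachable f x z
  reachable-trans {x} (k , refl) (l , refl) = l + k , iter-+ f l k x

  reachable-induction : ∀ {ℓ} (R : A → A → Set ℓ) → (∀ {x} → R x x) →
    (∀ {x y z} → R x y → R y z → R x z) → (∀ z → R z (f z)) →
    ∀ {x y} → Reachable f x y → R x y
  reachable-induction R R-refl R-trans R-step {x} (k , refl) = go k
    where
    go : ∀ k → R x (iter f k x)
    go zero    = R-refl
    go (suc k) = R-trans (go k) (R-step _)

isCycleMin? : ∀ {m} (f : Fin m → Fin m) → Decidable (IsCycleMin f)
isCycleMin? f i = Finₚ.all? (λ k → i Finₚ.≤? iter f (toℕ k) i)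

reachable-cycleMin : ∀ {m} (f : Fin m → Fin m) x → ∃[ y ] Reachable f x y × IsCycleMin f y
reachable-cycleMin {m} f x = go x (<-wellFounded x)
  where
  go : ∀ x → Acc Fin._<_ x → ∃[ y ] Reachable f x y × IsCycleMin f y
  go x (acc smaller) with isCycleMin? f x
  ... | yes min = x , reachable-refl , min
  ... | no ¬min with Finₚ.¬∀⟶∃¬ m _ (λ k → x Finₚ.≤? iter f (toℕ k) x) ¬min
  ...   | k , x≰fᵏx with go (iter f (toℕ k) x) (smaller (≰⇒> x≰fᵏx))
  ...     | y , fᵏx↝y , min = y , reachable-trans (toℕ k , refl) fᵏx↝y , min

numCycles-cong : ∀ {m} {f g : Fin m → Fin m} → f ≗ g → numCycles f ≡ numCycles g
numCycles-cong {m} {f} {g} f≗g = ≤-antisym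
  (length-filter-mono (isCycleMin? f) (isCycleMin? g) (All.universal (transport f≗g) (allFin m)))
  (length-filter-mono (isCycleMin? g) (isCycleMin? f) (All.universal (transport (sym ∘ f≗g)) (allFin m)))
  where
  transport : ∀ {f g : Fin m → Fin m} → f ≗ g → ∀ x → IsCycleMin f x → IsCycleMin g x
  transport f≗g x min k = subst (x Fin.≤_) (iter-cong f≗g (toℕ k) x) (min k)

numCycles-identity : ∀ {m} {f : Fin m → Fin m} → (∀ x → f x ≡ x) → numCycles f ≡ m
numCycles-identity {m} {f} f≗id = trans
  (cong length (filter-all (isCycleMin? f) (All.universal isMin (allFin m))))
  (length-tabulate id)
  where
  isMin : ∀ x → IsCycleMin f x
  isMin x k = Finₚ.≤-reflexive (sym (iter-fixedPoint f (f≗id x) (toℕ k)))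

⟨$⟩ʳ-injective : ∀ {m} (σ : Permutation′ m) → Injective _≡_ _≡_ (σ ⟨$⟩ʳ_)
⟨$⟩ʳ-injective σ eq = trans (sym (inverseˡ σ)) (trans (cong (σ ⟨$⟩ˡ_) eq) (inverseˡ σ))

module _ {m} (σ : Permutation′ m) where

  private
    s = σ ⟨$⟩ʳ_

  iter-injective : ∀ k {x y} → iter s k x ≡ iter s k y → x ≡ y
  iter-injective zero    eq = eq
  iter-injective (suc k) eq = iter-injective k (⟨$⟩ʳ-injective σ eq)

  period : ∀ x → ∃[ p ] suc p ≤ m × iter s (suc p) x ≡ x
  period x with Finₚ.pigeonhole (n<1+n m) (λ i → iter s (toℕ i) x)
  ... | i , j , i<j , sⁱx≡sʲx = p , 1+p≤m , iter-injective (toℕ i) sⁱ⁺¹⁺ᵖx≡sⁱx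
    where
    p = toℕ j ∸ suc (toℕ i)
    1+i+p≡j : suc (toℕ i + p) ≡ toℕ j
    1+i+p≡j = m+[n∸m]≡n i<j
    1+p≤m : suc p ≤ m
    1+p≤m = ≤-trans (s≤s (m≤n+m p (toℕ i))) (≤-trans (≤-reflexive 1+i+p≡j) (Finₚ.toℕ≤pred[n] j))
    sⁱ⁺¹⁺ᵖx≡sⁱx : iter s (toℕ i) (iter s (suc p) x) ≡ iter s (toℕ i) x
    sⁱ⁺¹⁺ᵖx≡sⁱx = begin
      iter s (toℕ i) (iter s (suc p) x) ≡⟨ iter-+ s (toℕ i) (suc p) x ⟨
      iter s (toℕ i + suc p) x          ≡⟨ cong (λ k → iter s k x) (trans (+-suc (toℕ i) p) 1+i+p≡j) ⟩
      iter s (toℕ j) x                  ≡⟨ sⁱx≡sʲx ⟨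
      iter s (toℕ i) x                  ∎
      where open ≡-Reasoning

  reachable-sym : ∀ {x y} → Reachable s x y → Reachable s y x
  reachable-sym {x} (k , refl) with period x
  ... | p , _ , s¹⁺ᵖx≡x = k * p , (begin
    iter s (k * p) (iter s k x) ≡⟨ iter-+ s (k * p) k x ⟨
    iter s (k * p + k) x        ≡⟨ cong (λ j → iter s j x) (trans (+-comm (k * p) k) (sym (*-suc k p))) ⟩
    iter s (k * suc p) x        ≡⟨ iter-* s s¹⁺ᵖx≡x k ⟩
    x                           ∎)
    where open ≡-Reasoning

  reachable-bounded : ∀ {x y} → Reachable s x y → ∃[ k ] iter s (toℕ {m} k) x ≡ y
  reachable-bounded {x} (k , refl) with period x
  ... | p , 1+p≤m , s¹⁺ᵖx≡x = fromℕ< k%[1+p]<m , (begin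
    iter s (toℕ (fromℕ< k%[1+p]<m)) x ≡⟨ cong (λ j → iter s j x) (Finₚ.toℕ-fromℕ< k%[1+p]<m) ⟩
    iter s (k % suc p) x              ≡⟨ iter-% s s¹⁺ᵖx≡x k ⟨
    iter s k x                        ∎)
    where
    open ≡-Reasoning
    k%[1+p]<m = <-≤-trans (m%n<n k (suc p)) 1+p≤m

  cycleMin-≤ : ∀ {x y} → IsCycleMin s x → Reachable s x y → x Fin.≤ y
  cycleMin-≤ {x} min x↝y with reachable-bounded x↝y
  ... | k , sᵏx≡y = subst (x Fin.≤_) sᵏx≡y (min k)

  cycleMin-unique : ∀ {x y} → IsCycleMin s x → IsCycleMin s y → Reachable s x y → x ≡ y
  cycleMin-unique minx miny x↝y =
    Finₚ.≤-antisym (cycleMin-≤ minx x↝y) (cycleMin-≤ miny (reachable-sym x↝y))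

-- Transpositions

data TransposeCase {m} (i j k : Fin m) : Set where
  at-i  : k ≡ i → TransposeCase i j k
  at-j  : k ≡ j → TransposeCase i j k
  other : k ≢ i → k ≢ j → TransposeCase i j k

transposeCase : ∀ {m} (i j k : Fin m) → TransposeCase i j k
transposeCase i j k with k Finₚ.≟ i | k Finₚ.≟ j
... | yes k≡i | _       = at-i k≡i
... | no _    | yes k≡j = at-j k≡j
... | no k≢i  | no k≢j  = other k≢i k≢j

module _ {m} (i j : Fin m) where

  transpose-i : transpose i j ⟨$⟩ʳ i ≡ j
  transpose-i with i Finₚ.≟ i
  ... | yes _  = refl
  ... | no i≢i = contradiction refl i≢i

  transpose-j : transpose i j ⟨$⟩ʳ j ≡ i
  transpose-j with j Finₚ.≟ i
  ... | yes j≡i = j≡i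
  ... | no _ with j Finₚ.≟ j
  ...   | yes _  = refl
  ...   | no j≢j = contradiction refl j≢j

  transpose-other : ∀ {k} → k ≢ i → k ≢ j → transpose i j ⟨$⟩ʳ k ≡ k
  transpose-other {k} k≢i k≢j with k Finₚ.≟ i
  ... | yes k≡i = contradiction k≡i k≢i
  ... | no _ with k Finₚ.≟ j
  ...   | yes k≡j = contradiction k≡j k≢j
  ...   | no _    = refl

  transpose-involutive : ∀ k → transpose i j ⟨$⟩ʳ (transpose i j ⟨$⟩ʳ k) ≡ k
  transpose-involutive k with transposeCase i j k
  ... | at-i refl     = trans (cong (transpose k j ⟨$⟩ʳ_) transpose-i) transpose-j
  ... | at-j refl     = trans (cong (transpose i k ⟨$⟩ʳ_) transpose-j) transpose-i
  ... | other k≢i k≢j = trans (cong (transpose i j ⟨$⟩ʳ_) (transpose-other k≢i k≢j))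
                              (transpose-other k≢i k≢j)

transpose-comm : ∀ {m} (i j k : Fin m) → transpose i j ⟨$⟩ʳ k ≡ transpose j i ⟨$⟩ʳ k
transpose-comm i j k with transposeCase i j k
... | at-i refl     = trans (transpose-i k j) (sym (transpose-j j k))
... | at-j refl     = trans (transpose-j i k) (sym (transpose-i k i))
... | other k≢i k≢j = trans (transpose-other i j k≢i k≢j) (sym (transpose-other j i k≢j k≢i))

transpose-conj : ∀ {m n} {f : Fin m → Fin n} → Injective _≡_ _≡_ f → ∀ i j k →
  f (transpose i j ⟨$⟩ʳ k) ≡ transpose (f i) (f j) ⟨$⟩ʳ f k
transpose-conj {f = f} f-inj i j k with transposeCase i j k
... | at-i refl     = trans (cong f (transpose-i k j)) (sym (transpose-i (f k) (f j)))
... | at-j refl     = trans (cong f (transpose-j i k)) (sym (transpose-j (f i) (f k)))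
... | other k≢i k≢j = trans (cong f (transpose-other i j k≢i k≢j))
                            (sym (transpose-other (f i) (f j) (k≢i ∘ f-inj) (k≢j ∘ f-inj)))

-- The number of cycles under multiplication by a transposition

module _ {m} (σ : Permutation′ m) (a b : Fin m) where

  private
    s = σ ⟨$⟩ʳ_

  OnOrbitOfEither : Fin m → Set
  OnOrbitOfEither x = Reachable s a x ⊎ Reachable s b x

  MergedOrbit : Fin m → Fin m → Set
  MergedOrbit x y = Reachable s x y ⊎ (OnOrbitOfEither x × OnOrbitOfEither y)

  private
    onOrbitOfEither-step : ∀ {x y} → Reachable s x y → OnOrbitOfEither x → OnOrbitOfEither y
    onOrbitOfEither-step x↝y (inj₁ a↝x) = inj₁ (reachable-trans a↝x x↝y)
    onOrbitOfEither-step x↝y (inj₂ b↝x) = inj₂ (reachable-trans b↝x x↝y)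

    mergedOrbit-trans : ∀ {x y z} → MergedOrbit x y → MergedOrbit y z → MergedOrbit x z
    mergedOrbit-trans (inj₁ x↝y)       (inj₁ y↝z)       = inj₁ (reachable-trans x↝y y↝z)
    mergedOrbit-trans (inj₁ x↝y)       (inj₂ (ey , ez)) = inj₂ (onOrbitOfEither-step (reachable-sym σ x↝y) ey , ez)
    mergedOrbit-trans (inj₂ (ex , ey)) (inj₁ y↝z)       = inj₂ (ex , onOrbitOfEither-step y↝z ey)
    mergedOrbit-trans (inj₂ (ex , _))  (inj₂ (_ , ez))  = inj₂ (ex , ez)

    crossing-impossible : ∀ {c d x y w w′} → IsCycleMin s x → IsCycleMin s y →
      Reachable s c x → Reachable s d w → w Fin.< x →
      Reachable s d y → Reachable s c w′ → w′ Fin.< y → ⊥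
    crossing-impossible minx miny c↝x d↝w w<x d↝y c↝w′ w′<y = <-irrefl refl
      (≤-<-trans (cycleMin-≤ σ miny (reachable-trans (reachable-sym σ d↝y) d↝w))
      (<-trans w<x (≤-<-trans (cycleMin-≤ σ minx (reachable-trans (reachable-sym σ c↝x) c↝w′)) w′<y)))

  numCycles-≤-suc-merged : (f : Fin m → Fin m) → (∀ z → MergedOrbit z (f z)) →
    numCycles s ≤ suc (numCycles f)
  numCycles-≤-suc-merged f step =
    length-filter-≤-suc (isCycleMin? f) (isCycleMin? s) (allFin⁺ m) lostAtMostOne
    where
    -- A σ-cycle minimum x that is no f-cycle minimum meets a smaller w on its
    -- f-orbit; w cannot lie on the σ-orbit of x, so x and w lie on the orbits of a and b.
    escape : ∀ {x} → IsCycleMin s x → ¬ IsCycleMin f x → ∃[ w ] w Fin.< x ×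
      ((Reachable s a x × Reachable s b w) ⊎ (Reachable s b x × Reachable s a w))
    escape {x} min ¬min with Finₚ.¬∀⟶∃¬ m _ (λ k → x Finₚ.≤? iter f (toℕ k) x) ¬min
    ... | k , x≰w with reachable-induction MergedOrbit (inj₁ reachable-refl) mergedOrbit-trans step (toℕ k , refl)
    ...   | inj₁ x↝w                   = contradiction (cycleMin-≤ σ min x↝w) x≰w
    ...   | inj₂ (inj₁ a↝x , inj₁ a↝w) = contradiction (cycleMin-≤ σ min (reachable-trans (reachable-sym σ a↝x) a↝w)) x≰w
    ...   | inj₂ (inj₁ a↝x , inj₂ b↝w) = _ , ≰⇒> x≰w , inj₁ (a↝x , b↝w)
    ...   | inj₂ (inj₂ b↝x , inj₁ a↝w) = _ , ≰⇒> x≰w , inj₂ (b↝x , a↝w)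
    ...   | inj₂ (inj₂ b↝x , inj₂ b↝w) = contradiction (cycleMin-≤ σ min (reachable-trans (reachable-sym σ b↝x) b↝w)) x≰w

    lostAtMostOne : ∀ {x y} → IsCycleMin s x → ¬ IsCycleMin f x → IsCycleMin s y → ¬ IsCycleMin f y → x ≡ y
    lostAtMostOne minx ¬minx miny ¬miny with escape minx ¬minx | escape miny ¬miny
    ... | _ , _ , inj₁ (a↝x , _) | _ , _ , inj₁ (a↝y , _) =
      cycleMin-unique σ minx miny (reachable-trans (reachable-sym σ a↝x) a↝y)
    ... | _ , _ , inj₂ (b↝x , _) | _ , _ , inj₂ (b↝y , _) =
      cycleMin-unique σ minx miny (reachable-trans (reachable-sym σ b↝x) b↝y)
    ... | _ , w<x , inj₁ (a↝x , b↝w) | _ , w′<y , inj₂ (b↝y , a↝w′) =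
      ⊥-elim (crossing-impossible minx miny a↝x b↝w w<x b↝y a↝w′ w′<y)
    ... | _ , w<x , inj₂ (b↝x , a↝w) | _ , w′<y , inj₁ (a↝y , b↝w′) =
      ⊥-elim (crossing-impossible minx miny b↝x a↝w w<x a↝y b↝w′ w′<y)

  numCycles-≤-suc-transposeʳ : numCycles s ≤ suc (numCycles ((σ ∘ₚ transpose a b) ⟨$⟩ʳ_))
  numCycles-≤-suc-transposeʳ = numCycles-≤-suc-merged _ step
    where
    step : ∀ z → MergedOrbit z (transpose a b ⟨$⟩ʳ s z)
    step z with transposeCase a b (s z)
    ... | at-i sz≡a = inj₂ (inj₁ (reachable-sym σ (1 , sz≡a)) ,
      subst OnOrbitOfEither (sym (trans (cong (transpose a b ⟨$⟩ʳ_) sz≡a) (transpose-i a b))) (inj₂ reachable-refl))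
    ... | at-j sz≡b = inj₂ (inj₂ (reachable-sym σ (1 , sz≡b)) ,
      subst OnOrbitOfEither (sym (trans (cong (transpose a b ⟨$⟩ʳ_) sz≡b) (transpose-j a b))) (inj₁ reachable-refl))
    ... | other sz≢a sz≢b = inj₁ (1 , sym (transpose-other a b sz≢a sz≢b))

  numCycles-≤-suc-transposeˡ : numCycles s ≤ suc (numCycles ((transpose a b ∘ₚ σ) ⟨$⟩ʳ_))
  numCycles-≤-suc-transposeˡ = numCycles-≤-suc-merged _ step
    where
    step : ∀ z → MergedOrbit z (s (transpose a b ⟨$⟩ʳ z))
    step z with transposeCase a b z
    ... | at-i refl = inj₂ (inj₁ reachable-refl ,
      subst OnOrbitOfEither (cong s (sym (transpose-i a b))) (inj₂ (reachable-step b)))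
    ... | at-j refl = inj₂ (inj₂ reachable-refl ,
      subst OnOrbitOfEither (cong s (sym (transpose-j a b))) (inj₁ (reachable-step a)))
    ... | other z≢a z≢b = inj₁ (1 , cong s (sym (transpose-other a b z≢a z≢b)))

numCycles-<-isolate : ∀ {m} (σ : Permutation′ m) {a} → σ ⟨$⟩ʳ a ≢ a →
  numCycles (σ ⟨$⟩ʳ_) < numCycles ((σ ∘ₚ transpose a (σ ⟨$⟩ʳ a)) ⟨$⟩ʳ_)
numCycles-<-isolate {m} σ {a} moved =
  length-filter-mono-< (isCycleMin? s) (isCycleMin? f) (All.universal min⇒min (allFin m)) gained
  where
  s = σ ⟨$⟩ʳ_
  b = s a
  σ′ = σ ∘ₚ transpose a b
  f = σ′ ⟨$⟩ʳ_

  step : ∀ z → Reachable s z (f z)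
  step z with transposeCase a b (s z)
  ... | at-i sz≡a = subst (Reachable s z) (sym (trans (cong (transpose a b ⟨$⟩ʳ_) sz≡a) (transpose-i a b)))
                          (reachable-trans (1 , sz≡a) (reachable-step a))
  ... | at-j sz≡b = subst (Reachable s z) (sym (trans (cong (transpose a b ⟨$⟩ʳ_) sz≡b) (transpose-j a b)))
                          (reachable-trans (1 , sz≡b) (reachable-sym σ (reachable-step a)))
  ... | other sz≢a sz≢b = 1 , sym (transpose-other a b sz≢a sz≢b)

  f-reachable⇒reachable : ∀ {x y} → Reachable f x y → Reachable s x y
  f-reachable⇒reachable = reachable-induction (Reachable s) reachable-refl reachable-trans step

  min⇒min : ∀ x → IsCycleMin s x → IsCycleMin f x
  min⇒min x min k = cycleMin-≤ σ min (f-reachable⇒reachable (toℕ k , refl))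

  fa≡a : f a ≡ a
  fa≡a = transpose-j a b

  min-a : IsCycleMin f a
  min-a k = Finₚ.≤-reflexive (sym (iter-fixedPoint f fa≡a (toℕ k)))

  -- The f-cycle of b has a minimum c ≠ a, since a is now fixed; a and c lie
  -- on one σ-cycle, which has only one minimum.
  gained : Any (λ x → IsCycleMin f x × ¬ IsCycleMin s x) (allFin m)
  gained with reachable-cycleMin f b
  ... | c , b↝c , min-c with isCycleMin? s a | isCycleMin? s c
  ...   | no ¬min    | _          = lose (∈-allFin a) (min-a , ¬min)
  ...   | yes _      | no ¬min    = lose (∈-allFin c) (min-c , ¬min)
  ...   | yes σmin-a | yes σmin-c = contradiction a≡c a≢c
    where
    a≡c : a ≡ c
    a≡c = cycleMin-unique σ σmin-a σmin-c (reachable-trans (reachable-step a) (f-reachable⇒reachable b↝c))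
    a≢c : a ≢ c
    a≢c refl with reachable-sym σ′ b↝c
    ... | k , fᵏa≡b = moved (sym (trans (sym (iter-fixedPoint f fa≡a k)) fᵏa≡b))

fixedPoints : ∀ {n} → Permutation′ n → ℕ
fixedPoints {n} π = length (filter (λ x → π ⟨$⟩ʳ x Finₚ.≟ x) (allFin n))

fixedPoints-< : ∀ {n} (π : Permutation′ n) {a} → π ⟨$⟩ʳ a ≢ a → fixedPoints π < n
fixedPoints-< {n} π {a} moved = subst (fixedPoints π <_) (length-tabulate id)
  (filter-notAll (λ x → π ⟨$⟩ʳ x Finₚ.≟ x) (allFin n) (lose (∈-allFin a) moved))

fixedPoints-<-isolate : ∀ {n} (π : Permutation′ n) {a} → π ⟨$⟩ʳ a ≢ a →
  fixedPoints π < fixedPoints (π ∘ₚ transpose a (π ⟨$⟩ʳ a))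
fixedPoints-<-isolate {n} π {a} moved = length-filter-mono-< _ _
  (All.universal stillFixed (allFin n)) (lose (∈-allFin a) (transpose-j a b , moved))
  where
  b = π ⟨$⟩ʳ a
  stillFixed : ∀ x → π ⟨$⟩ʳ x ≡ x → transpose a b ⟨$⟩ʳ (π ⟨$⟩ʳ x) ≡ x
  stillFixed x πx≡x = trans (cong (transpose a b ⟨$⟩ʳ_) πx≡x) (transpose-other a b x≢a x≢b)
    where
    x≢a : x ≢ a
    x≢a refl = moved πx≡x
    x≢b : x ≢ b
    x≢b x≡b = x≢a (⟨$⟩ʳ-injective π (trans πx≡x x≡b))

-- The permutation π̄

shiftCycle⁻¹ : ∀ {n} → Fin (suc n) → Fin (suc n)
shiftCycle⁻¹ {n} zero = fromℕ n
shiftCycle⁻¹ (suc i)  = inject₁ i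

shiftCycle-shiftCycle⁻¹ : ∀ {n} (x : Fin (suc n)) → shiftCycle (shiftCycle⁻¹ x) ≡ x
shiftCycle-shiftCycle⁻¹ {n} zero with n ℕ.≟ toℕ (fromℕ n)
... | yes _  = refl
... | no n≢n = contradiction (sym (Finₚ.toℕ-fromℕ n)) n≢n
shiftCycle-shiftCycle⁻¹ {n} (suc i) with n ℕ.≟ toℕ (inject₁ i)
... | yes n≡i = contradiction n≡i (Finₚ.toℕ-inject₁-≢ i)
... | no n≢i  = cong suc (Finₚ.lower₁-inject₁′ i n≢i)

shiftCycle⁻¹-shiftCycle : ∀ {n} (x : Fin (suc n)) → shiftCycle⁻¹ (shiftCycle x) ≡ x
shiftCycle⁻¹-shiftCycle {n} x with n ℕ.≟ toℕ x
... | yes n≡x = Finₚ.toℕ-injective (trans (Finₚ.toℕ-fromℕ n) n≡x)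
... | no n≢x  = Finₚ.inject₁-lower₁ x n≢x

rotate : ∀ {n} → Permutation′ (suc n)
rotate = permutation shiftCycle shiftCycle⁻¹ shiftCycle-shiftCycle⁻¹ shiftCycle⁻¹-shiftCycle

-- _∘ₚ_ composes left to right.  The cycle (0, π_n, …, π_1) is the conjugate
-- of (0, n, …, 1) = rotate⁻¹ by lift₀ π, so π̄ = rotate ∘ lift₀ π ∘ rotate⁻¹ ∘ lift₀ π⁻¹.
πbarₚ : ∀ {n} → Permutation′ n → Permutation′ (suc n)
πbarₚ π = lift₀ (flip π) ∘ₚ flip rotate ∘ₚ lift₀ π ∘ₚ rotate

πbar≗πbarₚ : ∀ {n} (π : Permutation′ n) → πbar π ≗ πbarₚ π ⟨$⟩ʳ_
πbar≗πbarₚ π x = cong shiftCycle (revCycle≗ π x)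
  where
  revCycle≗ : ∀ {n} (π : Permutation′ n) x →
    revCycle π x ≡ lift₀ π ⟨$⟩ʳ (shiftCycle⁻¹ (lift₀ (flip π) ⟨$⟩ʳ x))
  revCycle≗ {zero}  π zero    = refl
  revCycle≗ {suc n} π zero    = refl
  revCycle≗ {suc n} π (suc j) with π ⟨$⟩ˡ j
  ... | zero  = refl
  ... | suc k = refl

lift₀-transposeˡ : ∀ {n} (ρ : Permutation′ n) i j →
  lift₀ (transpose i j ∘ₚ ρ) ≈ transpose (suc i) (suc j) ∘ₚ lift₀ ρ
lift₀-transposeˡ ρ i j z =
  trans (sym (lift₀-comp (transpose i j) ρ z)) (cong (lift₀ ρ ⟨$⟩ʳ_) (sym (lift₀-transpose i j z)))

lift₀-transposeʳ : ∀ {n} (ρ : Permutation′ n) i j →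
  lift₀ (ρ ∘ₚ transpose i j) ≈ lift₀ ρ ∘ₚ transpose (suc i) (suc j)
lift₀-transposeʳ ρ i j z = trans (sym (lift₀-comp ρ (transpose i j) z)) (sym (lift₀-transpose i j _))

πbarₚ-transpose : ∀ {n} (π : Permutation′ n) (a b : Fin n) →
  πbarₚ (π ∘ₚ transpose a b) ≈
  transpose (suc a) (suc b) ∘ₚ πbarₚ π ∘ₚ transpose (rotate ⟨$⟩ʳ suc a) (rotate ⟨$⟩ʳ suc b)
πbarₚ-transpose π a b x = begin
  rotate ⟨$⟩ʳ (lift₀ (π ∘ₚ τ) ⟨$⟩ʳ (shiftCycle⁻¹ (lift₀ (flip τ ∘ₚ flip π) ⟨$⟩ʳ x)))
    ≡⟨ cong (λ z → rotate ⟨$⟩ʳ (lift₀ (π ∘ₚ τ) ⟨$⟩ʳ (shiftCycle⁻¹ z)))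
            (trans (lift₀-transposeˡ (flip π) b a x) (cong (lift₀ (flip π) ⟨$⟩ʳ_) (transpose-comm (suc b) (suc a) x))) ⟩
  rotate ⟨$⟩ʳ (lift₀ (π ∘ₚ τ) ⟨$⟩ʳ y)
    ≡⟨ cong (rotate ⟨$⟩ʳ_) (lift₀-transposeʳ π a b y) ⟩
  rotate ⟨$⟩ʳ (transpose (suc a) (suc b) ⟨$⟩ʳ (lift₀ π ⟨$⟩ʳ y))
    ≡⟨ transpose-conj (⟨$⟩ʳ-injective rotate) (suc a) (suc b) _ ⟩
  transpose (rotate ⟨$⟩ʳ suc a) (rotate ⟨$⟩ʳ suc b) ⟨$⟩ʳ (rotate ⟨$⟩ʳ (lift₀ π ⟨$⟩ʳ y)) ∎
  where
  open ≡-Reasoning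
  τ = transpose a b
  y = shiftCycle⁻¹ (lift₀ (flip π) ⟨$⟩ʳ (transpose (suc a) (suc b) ⟨$⟩ʳ x))

numCycles-πbar-transpose : ∀ {n} (π : Permutation′ n) (a b : Fin n) →
  numCycles (πbar (π ∘ₚ transpose a b)) ≤ 2 + numCycles (πbar π)
numCycles-πbar-transpose π a b = begin
  numCycles (πbar (π ∘ₚ transpose a b))       ≡⟨ numCycles-cong (λ x → trans (πbar≗πbarₚ _ x) (πbarₚ-transpose π a b x)) ⟩
  numCycles ((T ∘ₚ P ∘ₚ R) ⟨$⟩ʳ_)             ≤⟨ numCycles-≤-suc-transposeʳ (T ∘ₚ P ∘ₚ R) a′ b′ ⟩
  suc (numCycles ((T ∘ₚ P ∘ₚ R) ∘ₚ R ⟨$⟩ʳ_))  ≡⟨ cong suc (numCycles-cong (transpose-involutive a′ b′ ∘ _)) ⟩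
  suc (numCycles ((T ∘ₚ P) ⟨$⟩ʳ_))            ≤⟨ s≤s (numCycles-≤-suc-transposeˡ (T ∘ₚ P) (suc a) (suc b)) ⟩
  2 + numCycles (T ∘ₚ T ∘ₚ P ⟨$⟩ʳ_)           ≡⟨ cong (2 +_) (numCycles-cong (cong (P ⟨$⟩ʳ_) ∘ transpose-involutive (suc a) (suc b))) ⟩
  2 + numCycles (P ⟨$⟩ʳ_)                     ≡⟨ cong (2 +_) (numCycles-cong (πbar≗πbarₚ π)) ⟨
  2 + numCycles (πbar π)                      ∎
  where
  open ≤-Reasoning
  a′ = rotate ⟨$⟩ʳ suc a
  b′ = rotate ⟨$⟩ʳ suc b
  T = transpose (suc a) (suc b)
  P = πbarₚ π
  R = transpose a′ b′

lift₀-identity : ∀ {n} (ρ : Permutation′ n) → (∀ i → ρ ⟨$⟩ʳ i ≡ i) → ∀ x → lift₀ ρ ⟨$⟩ʳ x ≡ x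
lift₀-identity ρ ρ≗id zero    = refl
lift₀-identity ρ ρ≗id (suc i) = cong suc (ρ≗id i)

flip-identity : ∀ {n} (ρ : Permutation′ n) → (∀ i → ρ ⟨$⟩ʳ i ≡ i) → ∀ i → flip ρ ⟨$⟩ʳ i ≡ i
flip-identity ρ ρ≗id i = trans (cong (ρ ⟨$⟩ˡ_) (sym (ρ≗id i))) (inverseˡ ρ)

πbar-identity : ∀ {n} (π : Permutation′ n) → (∀ i → π ⟨$⟩ʳ i ≡ i) → ∀ x → πbar π x ≡ x
πbar-identity π π≗id x = begin
  πbar π x
    ≡⟨ πbar≗πbarₚ π x ⟩
  rotate ⟨$⟩ʳ (lift₀ π ⟨$⟩ʳ (shiftCycle⁻¹ (lift₀ (flip π) ⟨$⟩ʳ x)))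
    ≡⟨ cong (λ y → rotate ⟨$⟩ʳ (lift₀ π ⟨$⟩ʳ (shiftCycle⁻¹ y))) (lift₀-identity (flip π) (flip-identity π π≗id) x) ⟩
  rotate ⟨$⟩ʳ (lift₀ π ⟨$⟩ʳ (shiftCycle⁻¹ x))
    ≡⟨ cong (rotate ⟨$⟩ʳ_) (lift₀-identity π π≗id (shiftCycle⁻¹ x)) ⟩
  shiftCycle (shiftCycle⁻¹ x)
    ≡⟨ shiftCycle-shiftCycle⁻¹ x ⟩
  x ∎
  where open ≡-Reasoning

CycleBound : ∀ {n} → Permutation′ n → Set
CycleBound {n} π = 2 * cΓ π + 1 ≤ n + numCycles (πbar π)

cycleBound-identity : ∀ {n} (π : Permutation′ n) → (∀ i → π ⟨$⟩ʳ i ≡ i) → CycleBound π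
cycleBound-identity {n} π π≗id = ≤-reflexive (begin
  2 * cΓ π + 1           ≡⟨ cong (λ c → 2 * c + 1) (numCycles-identity π≗id) ⟩
  2 * n + 1              ≡⟨ 2*n+1≡n+[1+n] n ⟩
  n + suc n              ≡⟨ cong (n +_) (numCycles-identity (πbar-identity π π≗id)) ⟨
  n + numCycles (πbar π) ∎)
  where
  open ≡-Reasoning
  2*n+1≡n+[1+n] : ∀ n → 2 * n + 1 ≡ n + suc n
  2*n+1≡n+[1+n] = solve-∀

cycleBound-isolate : ∀ {n} (π : Permutation′ n) {a} → π ⟨$⟩ʳ a ≢ a →
  CycleBound (π ∘ₚ transpose a (π ⟨$⟩ʳ a)) → CycleBound π
cycleBound-isolate {n} π {a} moved bound = +-cancelˡ-≤ 2 _ _ (begin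
  2 + (2 * cΓ π + 1)           ≡⟨ 2+[2*c+1]≡2*[1+c]+1 (cΓ π) ⟩
  2 * suc (cΓ π) + 1           ≤⟨ +-monoˡ-≤ 1 (*-monoʳ-≤ 2 (numCycles-<-isolate π moved)) ⟩
  2 * cΓ π′ + 1                ≤⟨ bound ⟩
  n + numCycles (πbar π′)      ≤⟨ +-monoʳ-≤ n (numCycles-πbar-transpose π a (π ⟨$⟩ʳ a)) ⟩
  n + (2 + numCycles (πbar π)) ≡⟨ m+[2+n]≡2+[m+n] n _ ⟩
  2 + (n + numCycles (πbar π)) ∎)
  where
  open ≤-Reasoning
  π′ = π ∘ₚ transpose a (π ⟨$⟩ʳ a)
  2+[2*c+1]≡2*[1+c]+1 : ∀ c → 2 + (2 * c + 1) ≡ 2 * suc c + 1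
  2+[2*c+1]≡2*[1+c]+1 = solve-∀
  m+[2+n]≡2+[m+n] : ∀ m n → m + (2 + n) ≡ 2 + (m + n)
  m+[2+n]≡2+[m+n] = solve-∀

identity-or-moved : ∀ {n} (π : Permutation′ n) → (∀ i → π ⟨$⟩ʳ i ≡ i) ⊎ ∃[ a ] π ⟨$⟩ʳ a ≢ a
identity-or-moved {n} π with Finₚ.all? (λ i → π ⟨$⟩ʳ i Finₚ.≟ i)
... | yes π≗id = inj₁ π≗id
... | no ¬π≗id = inj₂ (Finₚ.¬∀⟶∃¬ n _ (λ i → π ⟨$⟩ʳ i Finₚ.≟ i) ¬π≗id)

cycleBound-fixedPoints : ∀ {n} k (π : Permutation′ n) → n ≤ k + fixedPoints π → CycleBound π
cycleBound-fixedPoints {n} k π n≤k+fix with identity-or-moved π | k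
... | inj₁ π≗id        | _      = cycleBound-identity π π≗id
... | inj₂ (a , moved) | zero   = contradiction n≤k+fix (<⇒≱ (fixedPoints-< π moved))
... | inj₂ (a , moved) | suc k′ = cycleBound-isolate π moved
  (cycleBound-fixedPoints k′ _ (≤-trans n≤k+fix (begin
    suc (k′ + fixedPoints π)                        ≡⟨ +-suc k′ (fixedPoints π) ⟨
    k′ + suc (fixedPoints π)                        ≤⟨ +-monoʳ-≤ k′ (fixedPoints-<-isolate π moved) ⟩
    k′ + fixedPoints (π ∘ₚ transpose a (π ⟨$⟩ʳ a)) ∎)))
  where open ≤-Reasoning

corollary4 : (n : ℕ) (π : Permutation′ n) →
    2 * cΓ π + 1 ≤ n + numCycles (πbar π)
corollary4 n π = cycleBound-fixedPoints n π (m≤m+n n (fixedPoints π))
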